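{- Let $k,m,n\in\mathbb N$ with $m\leq n$, let $M$ be a $k\times m$ matrix with entries from $\mathbb Q$, let $F=\{h_{\vec x}:\vec x\in\mathbb A^n\}$, and let $\sigma$ and $\eta$ be injections from $\{1,\dots,m\}$ to $\{1,\dots,n\}$. Then $P_{M,F,\sigma}=P_{M,F,\eta}$.
   Context: $\mathbb A$ is a fixed nonempty finite alphabet, $S_0=\mathbb A^+$ the free semigroup of nonempty words over $\mathbb A$, and $S_n$ the set of nonempty words over $\mathbb A\cup\{v_1,\dots,v_n\}$ (distinct variables not in $\mathbb A$) in which each $v_i$ occurs. For $\vec x\in\mathbb A^n$, $h_{\vec x}:S_n\to S_0$ is $h_{\vec x}(w)=w(\vec x)$, the word obtained by replacing each $v_i$ by $x_i$. $\mu_j(w)=|w|_{v_j}$. For a finite nonempty set $F$ of homomorphisms $S_n\to S_0$ and an injection $\sigma:\{1,\dots,m\}\to\{1,\dots,n\}$, $P_{M,F,\sigma}$ is the set of $\vec p=(p_1,\dots,p_k)\in(\beta\mathbb N)^k$ such that whenever $D$ is a piecewise syndetic subset of $S_0$ and $B_i\in p_i$ for all $i\le k$, there exists $w\in S_n$ with $\nu(w)\in D$ for all $\nu\in F$ and $M(\mu_{\sigma(1)}(w),\dots,\mu_{\sigma(m)}(w))^{T}\in\prod_{i=1}^kB_i$. Here $\beta X$ is the Stone–Čech compactification (ultrafilters) of the discrete semigroup $X$, $K(\beta X)$ its smallest ideal, and $D\subseteq X$ is piecewise syndetic if $D\in p$ for some $p\in K(\beta X)$. -}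

module Defs where

open import Data.Nat using (ℕ; zero; suc)
open import Data.Fin using (Fin)
open import Data.Product using (Σ; ∃; _×_; _,_)
open import Data.Sum using (_⊎_; inj₁; inj₂)
open import Data.Empty using (⊥)
open import Data.List using (List; []; _∷_; map)
open import Data.List.Relation.Unary.Any using (Any)
open import Data.List.NonEmpty using (List⁺; toList; _⁺++⁺_; concatMap)
import Data.List.NonEmpty as L⁺
open import Data.Integer using (+_)
open import Data.Rational using (ℚ; _+_; _*_; 0ℚ; _/_)
open import Relation.Nullary using (¬_)
open import Relation.Binary.PropositionalEquality using (_≡_)
open import Function.Definitions using (Injective)

record Ultrafilter (X : Set) : Set₁ where
  field
    _∈U : (X → Set) → Set
    upward : ∀ (A B : X → Set) → (∀ x → A x → B x) → A ∈U → B ∈U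
    inter  : ∀ (A B : X → Set) → A ∈U → B ∈U → (λ x → A x × B x) ∈U
    proper : ¬ ((λ _ → ⊥) ∈U)
    total  : ∀ (A : X → Set) → A ∈U ⊎ (λ x → ¬ A x) ∈U
open Ultrafilter public

-- The semigroup operation of βX extended from a semigroup (X , _·_):
-- A ∈ p·q  iff  {x : x⁻¹A ∈ q} ∈ p,  where x⁻¹A = {y : x·y ∈ A}.
-- IsProduct _·_ p q r  says that r = p·q.
IsProduct : {X : Set} → (X → X → X) → Ultrafilter X → Ultrafilter X → Ultrafilter X → Set₁
IsProduct _·_ p q r =
  ∀ (A : _ → Set) → ((r ∈U) A → (p ∈U) (λ x → (q ∈U) (λ y → A (x · y))))
                  × ((p ∈U) (λ x → (q ∈U) (λ y → A (x · y))) → (r ∈U) A)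

record IsIdeal {X : Set} (_·_ : X → X → X) (I : Ultrafilter X → Set) : Set₁ where
  field
    nonempty : Σ (Ultrafilter X) I
    right    : ∀ p q r → I p → IsProduct _·_ p q r → I r
    left     : ∀ p q r → I q → IsProduct _·_ p q r → I r

-- p ∈ K(βX): p lies in the smallest ideal, i.e. in every ideal of βX.
InK : {X : Set} → (X → X → X) → Ultrafilter X → Set₁
InK _·_ p = ∀ (I : Ultrafilter _ → Set) → IsIdeal _·_ I → I p

PiecewiseSyndetic : {X : Set} → (X → X → X) → (X → Set) → Set₁
PiecewiseSyndetic _·_ D = Σ (Ultrafilter _) λ p → InK _·_ p × (p ∈U) D

-- Words.  The alphabet 𝔸 is Fin (suc a) (a nonempty finite alphabet).

S₀ : ℕ → Set
S₀ a = List⁺ (Fin (suc a))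

-- nonempty words over 𝔸 ∪ {v₁,…,vₙ}  (variable vⱼ is inj₂ j)
Word : ℕ → ℕ → Set
Word a n = List⁺ (Fin (suc a) ⊎ Fin n)

InSn : ∀ {a n} → Word a n → Set
InSn {n = n} w = ∀ (j : Fin n) → Any (λ c → c ≡ inj₂ j) (toList w)

-- h_x(w) = w(x): replace each vⱼ by the letter xⱼ
subst : ∀ {a n} → (Fin n → Fin (suc a)) → Word a n → S₀ a
subst x w = L⁺.map f w
  where
  f : _ → _
  f (inj₁ c) = c
  f (inj₂ j) = x j

countVar : ∀ {a n} → Fin n → List (Fin (suc a) ⊎ Fin n) → ℕ
countVar j [] = 0
countVar j (inj₁ _ ∷ cs) = countVar j cs
countVar j (inj₂ i ∷ cs) with Data.Fin._≟_ i j
... | Relation.Nullary.yes _ = suc (countVar j cs)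
... | Relation.Nullary.no _  = countVar j cs
  where import Data.Fin
        import Relation.Nullary

μ : ∀ {a n} → Fin n → Word a n → ℕ
μ j w = countVar j (toList w)

ℕtoℚ : ℕ → ℚ
ℕtoℚ n = (+ n) / 1

sumFin : ∀ m → (Fin m → ℚ) → ℚ
sumFin zero f = 0ℚ
sumFin (suc m) f = f Fin.zero + sumFin m (λ j → f (Fin.suc j))
  where import Data.Fin as Fin

matVec : ∀ {k m} → (Fin k → Fin m → ℚ) → (Fin m → ℚ) → Fin k → ℚ
matVec {m = m} M v i = sumFin m (λ j → M i j * v j)

-- ℕ is the positive integers {1,2,…}; we represent it by Agda's ℕ via
-- the shift b ↦ b+1, so βℕ = Ultrafilter ℕ where index b stands for b+1.

P : ∀ (a k m n : ℕ) → (Fin k → Fin m → ℚ) → (Fin m → Fin n)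
    → (Fin k → Ultrafilter ℕ) → Set₁
P a k m n M σ p =
  ∀ (D : S₀ a → Set) → PiecewiseSyndetic {S₀ a} _⁺++⁺_ D →
  ∀ (B : Fin k → ℕ → Set) → (∀ i → (p i ∈U) (B i)) →
  Σ (Word a n) λ w → InSn w
    × (∀ (x : Fin n → Fin (suc a)) → D (subst x w))
    × (∀ (i : Fin k) → Σ ℕ λ b →
         (matVec M (λ j → ℕtoℚ (μ (σ j) w)) i ≡ ℕtoℚ (suc b)) × B i b)

-- Two injections σ, η : Fin m → Fin n differ by a permutation π of the
-- variables (π ∘ σ = η).  Renaming the variables of a word w by π does not
-- change the set {h_x(w) : x ∈ 𝔸ⁿ} of its images, keeps every variable
-- present, and moves the occurrence count of v_{σ j} to v_{η j}; hence a
-- witness for P_{M,F,σ} becomes a witness for P_{M,F,η}.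
module Submission where

open import Defs
open import Data.Nat using (ℕ; _≤_; suc)
open import Data.Fin using (Fin; _≟_)
import Data.Fin as Fin
open import Data.Fin.Properties using (suc-injective)
open import Data.Fin.Permutation using (Permutation′; transpose; _∘ₚ_; _⟨$⟩ʳ_; _⟨$⟩ˡ_)
import Data.Fin.Permutation as Perm
import Data.Fin.Permutation.Components as PC
open import Data.Product using (_×_; Σ; _,_)
open import Data.Sum using (_⊎_; inj₁; inj₂; map₂; [_,_]′)
open import Data.Rational using (ℚ; _+_; _*_)
open import Data.List using (List; []; _∷_)
import Data.List as List
open import Data.List.NonEmpty using (_∷_; toList)
import Data.List.NonEmpty as List⁺
import Data.List.NonEmpty.Properties as List⁺
open import Data.List.Relation.Unary.Any using (Any)
import Data.List.Relation.Unary.Any as Any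
import Data.List.Relation.Unary.Any.Properties as Any
open import Function using (_∘_; id)
open import Function.Bundles using (Injection)
open import Function.Definitions using (Injective)
open import Function.Properties.Inverse using (↔⇒↣)
open import Relation.Nullary using (yes; no)
open import Relation.Nullary.Decidable using (dec-true; dec-false)
import Relation.Binary.PropositionalEquality as ≡
open import Relation.Binary.PropositionalEquality
  using (_≡_; _≢_; refl; sym; trans; cong; module ≡-Reasoning)
open import Data.Empty using (⊥-elim)

private
  variable
    a k m n n′ : ℕ

transpose-left : (i j : Fin n) → PC.transpose i j i ≡ j
transpose-left i j rewrite dec-true (i ≟ i) refl = refl

transpose-fixed : (i j l : Fin n) → l ≢ i → l ≢ j → PC.transpose i j l ≡ l
transpose-fixed i j l l≢i l≢j rewrite dec-false (l ≟ i) l≢i | dec-false (l ≟ j) l≢j = refl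

permutation-injective : (π : Permutation′ n) → Injective _≡_ _≡_ (π ⟨$⟩ʳ_)
permutation-injective π = Injection.injective (↔⇒↣ π)

-- π is built from the permutation for the tails by post-composing with the
-- transposition that sends π′ (σ 0) to η 0; it fixes all η (suc j).
injections-differ-by-permutation : (σ η : Fin m → Fin n) →
  Injective _≡_ _≡_ σ → Injective _≡_ _≡_ η →
  Σ (Permutation′ n) λ π → ∀ j → π ⟨$⟩ʳ σ j ≡ η j
injections-differ-by-permutation {m = 0} σ η _ _ = Perm.id , λ ()
injections-differ-by-permutation {m = suc m} σ η σ-inj η-inj
  with injections-differ-by-permutation (σ ∘ Fin.suc) (η ∘ Fin.suc)
         (suc-injective ∘ σ-inj) (suc-injective ∘ η-inj)
... | π′ , π′∘σ≡η = π , π∘σ≡η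
  where
  π : Permutation′ _
  π = π′ ∘ₚ transpose (π′ ⟨$⟩ʳ σ Fin.zero) (η Fin.zero)

  π∘σ≡η : ∀ j → π ⟨$⟩ʳ σ j ≡ η j
  π∘σ≡η Fin.zero = transpose-left (π′ ⟨$⟩ʳ σ Fin.zero) (η Fin.zero)
  π∘σ≡η (Fin.suc j) = begin
    PC.transpose (π′ ⟨$⟩ʳ σ Fin.zero) (η Fin.zero) (π′ ⟨$⟩ʳ σ (Fin.suc j))
      ≡⟨ cong (PC.transpose _ _) (π′∘σ≡η j) ⟩
    PC.transpose (π′ ⟨$⟩ʳ σ Fin.zero) (η Fin.zero) (η (Fin.suc j))
      ≡⟨ transpose-fixed _ _ _ ≢π′σ₀ ≢η₀ ⟩
    η (Fin.suc j) ∎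
    where
    open ≡-Reasoning
    ≢π′σ₀ : η (Fin.suc j) ≢ π′ ⟨$⟩ʳ σ Fin.zero
    ≢π′σ₀ e with σ-inj (permutation-injective π′ (trans (π′∘σ≡η j) e))
    ... | ()
    ≢η₀ : η (Fin.suc j) ≢ η Fin.zero
    ≢η₀ e with η-inj e
    ... | ()

rename : (Fin n → Fin n′) → Word a n → Word a n′
rename τ = List⁺.map (map₂ τ)

subst-as-map : (x : Fin n → Fin (suc a)) (w : Word a n) → subst x w ≡ List⁺.map [ id , x ]′ w
subst-as-map x w@(_ ∷ _) = List⁺.map-cong (λ { (inj₁ _) → refl ; (inj₂ _) → refl }) w

subst-rename : (τ : Fin n → Fin n′) (x : Fin n′ → Fin (suc a)) (w : Word a n) →
               subst x (rename τ w) ≡ subst (x ∘ τ) w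
subst-rename τ x w = begin
  subst x (rename τ w)                      ≡⟨ subst-as-map x (rename τ w) ⟩
  List⁺.map [ id , x ]′ (rename τ w)        ≡⟨ List⁺.map-∘ w ⟨
  List⁺.map ([ id , x ]′ ∘ map₂ τ) w        ≡⟨ List⁺.map-cong (λ { (inj₁ _) → refl ; (inj₂ _) → refl }) w ⟩
  List⁺.map [ id , x ∘ τ ]′ w               ≡⟨ subst-as-map (x ∘ τ) w ⟨
  subst (x ∘ τ) w                           ∎
  where open ≡-Reasoning

countVar-rename : (τ : Fin n → Fin n′) → Injective _≡_ _≡_ τ →
                  ∀ i (cs : List (Fin (suc a) ⊎ Fin n)) →
                  countVar (τ i) (List.map (map₂ τ) cs) ≡ countVar i cs
countVar-rename τ τ-inj i [] = refl
countVar-rename τ τ-inj i (inj₁ _ ∷ cs) = countVar-rename τ τ-inj i cs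
countVar-rename τ τ-inj i (inj₂ l ∷ cs) with τ l ≟ τ i | l ≟ i
... | yes _   | yes _   = cong suc (countVar-rename τ τ-inj i cs)
... | yes τ≡  | no l≢i  = ⊥-elim (l≢i (τ-inj τ≡))
... | no τ≢   | yes l≡i = ⊥-elim (τ≢ (cong τ l≡i))
... | no _    | no _    = countVar-rename τ τ-inj i cs

μ-rename : (τ : Fin n → Fin n′) → Injective _≡_ _≡_ τ →
           ∀ i (w : Word a n) → μ (τ i) (rename τ w) ≡ μ i w
μ-rename τ τ-inj i (c ∷ cs) = countVar-rename τ τ-inj i (c ∷ cs)

InSn-rename : (π : Permutation′ n) (w : Word a n) → InSn w → InSn (rename (π ⟨$⟩ʳ_) w)
InSn-rename π w@(_ ∷ _) w∈Sn j =
  ≡.subst (λ l → Any (_≡ inj₂ l) (toList (rename (π ⟨$⟩ʳ_) w))) (Perm.inverseʳ π)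
    (Any.map⁺ (Any.map (cong (map₂ (π ⟨$⟩ʳ_))) (w∈Sn (π ⟨$⟩ˡ j))))

sumFin-cong : ∀ m {f g : Fin m → ℚ} → (∀ j → f j ≡ g j) → sumFin m f ≡ sumFin m g
sumFin-cong 0 f≗g = refl
sumFin-cong (suc m) f≗g = ≡.cong₂ _+_ (f≗g Fin.zero) (sumFin-cong m (f≗g ∘ Fin.suc))

P-permute : ∀ (M : Fin k → Fin m → ℚ) (σ η : Fin m → Fin n) (π : Permutation′ n) →
            (∀ j → π ⟨$⟩ʳ σ j ≡ η j) →
            ∀ p → P a k m n M σ p → P a k m n M η p
P-permute {m = m} M σ η π π∘σ≡η p Pσ D D-ps B p∋B
  with Pσ D D-ps B p∋B
... | w , w∈Sn , D∋hw , Mμw∈B =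
  rename τ w , InSn-rename π w w∈Sn , D∋hw′ , Mμw′∈B
  where
  τ = π ⟨$⟩ʳ_
  D∋hw′ : ∀ x → D (subst x (rename τ w))
  D∋hw′ x = ≡.subst D (sym (subst-rename τ x w)) (D∋hw (x ∘ τ))
  μη≡μσ : ∀ j → μ (η j) (rename τ w) ≡ μ (σ j) w
  μη≡μσ j = trans (cong (λ l → μ l (rename τ w)) (sym (π∘σ≡η j)))
                  (μ-rename τ (permutation-injective π) (σ j) w)
  Mμw′∈B : ∀ i → Σ ℕ λ b →
           (matVec M (λ j → ℕtoℚ (μ (η j) (rename τ w))) i ≡ ℕtoℚ (suc b)) × B i b
  Mμw′∈B i with Mμw∈B i
  ... | b , Mμw≡b , b∈B =
    b , trans (sumFin-cong m (λ j → cong (λ c → M i j * ℕtoℚ c) (μη≡μσ j))) Mμw≡b , b∈B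

theorem4p3 : ∀ (a k m n : ℕ) → m ≤ n → (M : Fin k → Fin m → ℚ)
             → (σ η : Fin m → Fin n) → Injective _≡_ _≡_ σ → Injective _≡_ _≡_ η
             → ∀ (p : Fin k → Ultrafilter ℕ)
             → (P a k m n M σ p → P a k m n M η p) × (P a k m n M η p → P a k m n M σ p)
theorem4p3 a k m n _ M σ η σ-inj η-inj p
  with injections-differ-by-permutation σ η σ-inj η-inj
... | π , π∘σ≡η = P-permute M σ η π π∘σ≡η p , P-permute M η σ (Perm.flip π) π⁻¹∘η≡σ p
  where
  π⁻¹∘η≡σ : ∀ j → π ⟨$⟩ˡ η j ≡ σ j
  π⁻¹∘η≡σ j = trans (cong (π ⟨$⟩ˡ_) (sym (π∘σ≡η j))) (Perm.inverseˡ π)
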